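{- For every $n\ge 0$ and every $k\ge 0$, the number of paths in $\mathcal M_n(UU)$ containing exactly $k$ occurrences of $UFU$ equals the number of paths in $\mathcal M_{n+1}(UD)$ containing exactly $k$ occurrences of $DU$.
   Context: A Motzkin path of length $n$ is a lattice path from $(0,0)$ to $(n,0)$ with steps $U=(1,1)$, $F=(1,0)$, $D=(1,-1)$ that never goes below the $x$-axis, viewed as a word in $U,F,D$. An occurrence of a word $w$ in a path is a position where $w$ appears as a block of consecutive steps. $\mathcal M_n(w_1,\dots,w_r)$ denotes the set of Motzkin paths of length $n$ containing no occurrence of any of $w_1,\dots,w_r$. -}

module Defs where

open import Data.Nat using (ℕ; zero; suc; _+_; _≡ᵇ_)
open import Data.Bool using (Bool; true; false; _∧_; _∨_; not; T; if_then_else_)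
open import Relation.Nullary.Decidable using (T?)
open import Data.List using (List; []; _∷_; length; filter; map; concatMap)
open import Data.Product using (_×_; _,_)
open import Relation.Nullary using (Dec; yes; no)
open import Relation.Binary.PropositionalEquality using (_≡_; refl)
open import Relation.Nullary.Decidable using (isYes)

-- Steps U = (1,1), F = (1,0), D = (1,-1)
data Step : Set where
  U F D : Step

Word : Set
Word = List Step

allWords : ℕ → List Word
allWords zero = [] ∷ []
allWords (suc n) = concatMap (λ w → (U ∷ w) ∷ (F ∷ w) ∷ (D ∷ w) ∷ []) (allWords n)

motzkinFrom : ℕ → Word → Bool
motzkinFrom zero [] = true
motzkinFrom (suc _) [] = false
motzkinFrom h (U ∷ w) = motzkinFrom (suc h) w
motzkinFrom h (F ∷ w) = motzkinFrom h w
motzkinFrom zero (D ∷ w) = false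
motzkinFrom (suc h) (D ∷ w) = motzkinFrom h w

IsMotzkin : Word → Bool
IsMotzkin = motzkinFrom zero

stepEq : Step → Step → Bool
stepEq U U = true
stepEq F F = true
stepEq D D = true
stepEq _ _ = false

isPrefix : Word → Word → Bool
isPrefix [] _ = true
isPrefix (_ ∷ _) [] = false
isPrefix (a ∷ p) (b ∷ w) = stepEq a b ∧ isPrefix p w

-- number of occurrences of p as a block of consecutive steps in w
-- (counted over all starting positions; overlaps allowed)
occ : Word → Word → ℕ
occ p [] = if isPrefix p [] then 1 else 0
occ p (a ∷ w) = (if isPrefix p (a ∷ w) then 1 else 0) + occ p w

avoids : Word → Word → Bool
avoids p w = occ p w ≡ᵇ 0

countMotzkin : ℕ → Word → Word → ℕ → ℕ
countMotzkin n avoid pat k =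
  length (filter (λ w → T? (IsMotzkin w ∧ avoids avoid w ∧ (occ pat w ≡ᵇ k))) (allWords n))

private
  open import Data.List using (length)
  mot : ℕ → ℕ
  mot n = length (filter (λ w → T? (IsMotzkin w)) (allWords n))
  _ : mot 5 ≡ 21
  _ = refl
  _ : occ (U ∷ U ∷ []) (U ∷ U ∷ U ∷ D ∷ D ∷ D ∷ []) ≡ 2
  _ = refl

module Submission where

-- Both classes are in bijection with one family of trees. A UU-avoiding Motzkin path is
-- uniquely ε, F P, U D P or U F A D M with the displayed D the first return to the axis, and a
-- non-empty UD-avoiding Motzkin path is uniquely F, F P, U P D or U P D Q with P, Q non-empty.
-- Reading a tree through the first grammar gives uuPath, and through the second, with the
-- subtrees of a node swapped, gives udPath, one step longer. Outside its subpaths U F A D M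
-- contains one UFU exactly when A starts with U, and U M D A one DU exactly when A starts
-- with U, so both statistics equal the same weight of the tree.

open import Defs
open import Data.Nat using (ℕ; zero; suc; _+_; _≤_; s≤s; _≡ᵇ_)
open import Data.Nat.Properties
  using (+-assoc; +-comm; +-identityʳ; +-suc; ≤-refl; ≤-trans; <⇒≤; n≤1+n; 0≢1+n; suc-injective;
         m+n≡0⇒m≡0; m+n≡0⇒n≡0; ≡ᵇ⇒≡; ≡⇒≡ᵇ)
open import Data.Bool using (T; false; _∧_; if_then_else_)
open import Data.Bool.Properties using (T-∧)
open import Data.Empty using (⊥-elim)
open import Data.List
  using (List; []; _∷_; _++_; null; length; map; filter; concatMap; cartesianProductWith)
open import Data.List.Properties
  using (length-map; length-++; length-++-≤ˡ; length-++-≤ʳ; map-id-local; map-∘; ∷-injective)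
open import Data.List.Membership.Propositional using (_∈_)
open import Data.List.Membership.Propositional.Properties
  using (∈-map⁺; ∈-map⁻; ∈-filter⁺; ∈-filter⁻; ∈-cartesianProductWith⁺; ∈-cartesianProductWith⁻)
open import Data.List.Membership.Propositional.Properties.WithK using (unique∧set⇒bag)
open import Data.List.Relation.Binary.BagAndSetEquality using (∼bag⇒↭)
open import Data.List.Relation.Binary.Permutation.Propositional.Properties using (↭-length)
open import Data.List.Relation.Unary.All as All using (All)
open import Data.List.Relation.Unary.Any using (here; there)
open import Data.List.Relation.Unary.Unique.Propositional using (Unique; []; _∷_)
import Data.List.Relation.Unary.Unique.Propositional.Properties as Unique
open import Data.Product using (_×_; _,_; proj₁; proj₂; swap; map₁; ∃)
open import Function.Base using (_∘_)
open import Function.Bundles using (_⇔_; mk⇔; Equivalence)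
open import Relation.Unary using (Decidable)
open import Relation.Binary.PropositionalEquality
  using (_≡_; _≢_; refl; sym; trans; cong; cong₂; subst; module ≡-Reasoning)
open ≡-Reasoning

unique-length-≡ : ∀ {A B : Set} {xs : List A} {ys : List B} (f : A → B) (g : B → A) →
  Unique xs → Unique ys →
  (∀ {x} → x ∈ xs → f x ∈ ys × g (f x) ≡ x) →
  (∀ {y} → y ∈ ys → g y ∈ xs × f (g y) ≡ y) →
  length xs ≡ length ys
unique-length-≡ {xs = xs} {ys} f g xs! ys! f-into g-into =
  trans (sym (length-map f xs)) (↭-length (∼bag⇒↭ (unique∧set⇒bag fxs! ys! (mk⇔ to from))))
  where
  fxs! : Unique (map f xs)
  fxs! = Unique.map⁻ {f = g}
    (subst Unique (trans (sym (map-id-local (All.tabulate (proj₂ ∘ f-into)))) (map-∘ xs)) xs!)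
  to : ∀ {y} → y ∈ map f xs → y ∈ ys
  to y∈ with ∈-map⁻ f y∈
  ... | x , x∈ , refl = proj₁ (f-into x∈)
  from : ∀ {y} → y ∈ ys → y ∈ map f xs
  from y∈ = subst (_∈ map f xs) (proj₂ (g-into y∈)) (∈-map⁺ f (proj₁ (g-into y∈)))

allWords-suc : ∀ n →
  allWords (suc n) ≡ cartesianProductWith (λ w s → s ∷ w) (allWords n) (U ∷ F ∷ D ∷ [])
allWords-suc n = go (allWords n)
  where
  go : ∀ ws → concatMap (λ w → (U ∷ w) ∷ (F ∷ w) ∷ (D ∷ w) ∷ []) ws
            ≡ cartesianProductWith (λ w s → s ∷ w) ws (U ∷ F ∷ D ∷ [])
  go [] = refl
  go (w ∷ ws) = cong (λ vs → (U ∷ w) ∷ (F ∷ w) ∷ (D ∷ w) ∷ vs) (go ws)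

allWords-unique : ∀ n → Unique (allWords n)
allWords-unique zero = All.[] ∷ []
allWords-unique (suc n) rewrite allWords-suc n =
  Unique.cartesianProductWith⁺ (λ w s → s ∷ w) (swap ∘ ∷-injective) (allWords-unique n)
    (((λ ()) All.∷ (λ ()) All.∷ All.[]) ∷ ((λ ()) All.∷ All.[]) ∷ All.[] ∷ [])

∈-allWords : ∀ w → w ∈ allWords (length w)
∈-allWords [] = here refl
∈-allWords (s ∷ w) rewrite allWords-suc (length w) =
  ∈-cartesianProductWith⁺ (λ w s → s ∷ w) (∈-allWords w) (∈-steps s)
  where
  ∈-steps : ∀ s → s ∈ U ∷ F ∷ D ∷ []
  ∈-steps U = here refl
  ∈-steps F = there (here refl)
  ∈-steps D = there (there (here refl))

allWords-length : ∀ n {w} → w ∈ allWords n → length w ≡ n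
allWords-length zero (here refl) = refl
allWords-length (suc n) w∈ rewrite allWords-suc n
  with _ , _ , v∈ , _ , refl ← ∈-cartesianProductWith⁻ (λ w s → s ∷ w) (allWords n) _ w∈
  = cong suc (allWords-length n v∈)

filter-allWords-length-≡ : ∀ {P Q : Word → Set} (P? : Decidable P) (Q? : Decidable Q) {n m}
  (f g : Word → Word) →
  (∀ {w} → length w ≡ n → P w → length (f w) ≡ m × Q (f w) × g (f w) ≡ w) →
  (∀ {v} → length v ≡ m → Q v → length (g v) ≡ n × P (g v) × f (g v) ≡ v) →
  length (filter P? (allWords n)) ≡ length (filter Q? (allWords m))
filter-allWords-length-≡ P? Q? {n} {m} f g f-maps g-maps =
  unique-length-≡ f g
    (Unique.filter⁺ P? (allWords-unique n)) (Unique.filter⁺ Q? (allWords-unique m))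
    (transfer P? Q? f g f-maps) (transfer Q? P? g f g-maps)
  where
  transfer : ∀ {P Q : Word → Set} (P? : Decidable P) (Q? : Decidable Q) {n m}
    (f g : Word → Word) →
    (∀ {w} → length w ≡ n → P w → length (f w) ≡ m × Q (f w) × g (f w) ≡ w) →
    ∀ {w} → w ∈ filter P? (allWords n) → f w ∈ filter Q? (allWords m) × g (f w) ≡ w
  transfer P? Q? {n} f g f-maps w∈ with w∈all , Pw ← ∈-filter⁻ P? w∈
    with refl , Qfw , gfw ← f-maps (allWords-length n w∈all) Pw
    = ∈-filter⁺ Q? (∈-allWords (f _)) Qfw , gfw

length-++-∷ : ∀ (xs : Word) x ys → length (xs ++ x ∷ ys) ≡ suc (length xs + length ys)
length-++-∷ xs x ys = trans (length-++ xs) (+-suc (length xs) (length ys))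

length-pieces : ∀ {n} (xs : Word) x ys →
  length (xs ++ x ∷ ys) ≤ n → length xs ≤ n × length ys ≤ n
length-pieces xs x ys le =
  ≤-trans (length-++-≤ˡ xs) le , ≤-trans (n≤1+n _) (≤-trans (length-++-≤ʳ (x ∷ ys) {xs}) le)

data Walk : ℕ → Word → Set where
  []  : Walk 0 []
  U∷_ : ∀ {h w} → Walk (suc h) w → Walk h (U ∷ w)
  F∷_ : ∀ {h w} → Walk h w → Walk h (F ∷ w)
  D∷_ : ∀ {h w} → Walk h w → Walk (suc h) (D ∷ w)

motzkinFrom⇒Walk : ∀ h w → T (motzkinFrom h w) → Walk h w
motzkinFrom⇒Walk zero    []      _ = []
motzkinFrom⇒Walk zero    (U ∷ w) t = U∷ motzkinFrom⇒Walk 1 w t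
motzkinFrom⇒Walk (suc h) (U ∷ w) t = U∷ motzkinFrom⇒Walk (suc (suc h)) w t
motzkinFrom⇒Walk zero    (F ∷ w) t = F∷ motzkinFrom⇒Walk zero w t
motzkinFrom⇒Walk (suc h) (F ∷ w) t = F∷ motzkinFrom⇒Walk (suc h) w t
motzkinFrom⇒Walk (suc h) (D ∷ w) t = D∷ motzkinFrom⇒Walk h w t

Walk⇒motzkinFrom : ∀ {h w} → Walk h w → T (motzkinFrom h w)
Walk⇒motzkinFrom []               = _
Walk⇒motzkinFrom {zero}  (U∷ p)   = Walk⇒motzkinFrom p
Walk⇒motzkinFrom {suc h} (U∷ p)   = Walk⇒motzkinFrom p
Walk⇒motzkinFrom {zero}  (F∷ p)   = Walk⇒motzkinFrom p
Walk⇒motzkinFrom {suc h} (F∷ p)   = Walk⇒motzkinFrom p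
Walk⇒motzkinFrom (D∷ p)           = Walk⇒motzkinFrom p

Walk-++ : ∀ {j h xs ys} → Walk j xs → Walk h ys → Walk (j + h) (xs ++ ys)
Walk-++ []     q = q
Walk-++ (U∷ p) q = U∷ Walk-++ p q
Walk-++ (F∷ p) q = F∷ Walk-++ p q
Walk-++ (D∷ p) q = D∷ Walk-++ p q

data FirstReturn (j : ℕ) : Word → Set where
  _·D·_ : ∀ {a m} → Walk j a → Walk 0 m → FirstReturn j (a ++ D ∷ m)

firstReturn : ∀ {j w} → Walk (suc j) w → FirstReturn j w
firstReturn (U∷ p) with firstReturn p
... | pa ·D· pm = (U∷ pa) ·D· pm
firstReturn (F∷ p) with firstReturn p
... | pa ·D· pm = (F∷ pa) ·D· pm
firstReturn {zero} (D∷ p) = [] ·D· p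
firstReturn {suc j} (D∷ p) with firstReturn p
... | pa ·D· pm = (D∷ pa) ·D· pm

splitAtReturn : ℕ → Word → Word × Word
splitAtReturn j       []      = [] , []
splitAtReturn j       (U ∷ w) = map₁ (U ∷_) (splitAtReturn (suc j) w)
splitAtReturn j       (F ∷ w) = map₁ (F ∷_) (splitAtReturn j w)
splitAtReturn zero    (D ∷ w) = [] , w
splitAtReturn (suc j) (D ∷ w) = map₁ (D ∷_) (splitAtReturn j w)

splitAtReturn-++ : ∀ {j a} m → Walk j a → splitAtReturn j (a ++ D ∷ m) ≡ (a , m)
splitAtReturn-++ m []     = refl
splitAtReturn-++ m (U∷ p) = cong (map₁ (U ∷_)) (splitAtReturn-++ m p)
splitAtReturn-++ m (F∷ p) = cong (map₁ (F ∷_)) (splitAtReturn-++ m p)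
splitAtReturn-++ m (D∷ p) = cong (map₁ (D ∷_)) (splitAtReturn-++ m p)

record Restricted (p q : Word) (k : ℕ) (w : Word) : Set where
  constructor restricted
  field
    walk        : Walk 0 w
    avoiding    : occ p w ≡ 0
    occurrences : occ q w ≡ k

restricted⇔ : ∀ {p q k w} → T (IsMotzkin w ∧ avoids p w ∧ (occ q w ≡ᵇ k)) ⇔ Restricted p q k w
restricted⇔ {p} {q} {k} {w} = mk⇔ to from
  where
  to : T (IsMotzkin w ∧ avoids p w ∧ (occ q w ≡ᵇ k)) → Restricted p q k w
  to t with mw , rest ← Equivalence.to T-∧ t with av , oc ← Equivalence.to T-∧ rest =
    restricted (motzkinFrom⇒Walk 0 w mw) (≡ᵇ⇒≡ _ _ av) (≡ᵇ⇒≡ _ _ oc)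
  from : Restricted p q k w → T (IsMotzkin w ∧ avoids p w ∧ (occ q w ≡ᵇ k))
  from (restricted pw av oc) =
    Equivalence.from T-∧ (Walk⇒motzkinFrom pw , Equivalence.from T-∧ (≡⇒≡ᵇ _ _ av , ≡⇒≡ᵇ _ _ oc))

countMotzkin-≡ : ∀ {n m p q p′ q′ k k′} (f g : Word → Word) →
  (∀ {w} → length w ≡ n → Restricted p q k w →
     length (f w) ≡ m × Restricted p′ q′ k′ (f w) × g (f w) ≡ w) →
  (∀ {v} → length v ≡ m → Restricted p′ q′ k′ v →
     length (g v) ≡ n × Restricted p q k (g v) × f (g v) ≡ v) →
  countMotzkin n p q k ≡ countMotzkin m p′ q′ k′
countMotzkin-≡ f g f-maps g-maps = filter-allWords-length-≡ _ _ f g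
  (λ lw Pw → fromRestricted (f-maps lw (Equivalence.to restricted⇔ Pw)))
  (λ lv Qv → fromRestricted (g-maps lv (Equivalence.to restricted⇔ Qv)))
  where
  fromRestricted : ∀ {A B : Set} {p q k w} → A × Restricted p q k w × B →
    A × T (IsMotzkin w ∧ avoids p w ∧ (occ q w ≡ᵇ k)) × B
  fromRestricted (a , r , b) = a , Equivalence.from restricted⇔ r , b

UU UFU UD DU : Word
UU  = U ∷ U ∷ []
UFU = U ∷ F ∷ U ∷ []
UD  = U ∷ D ∷ []
DU  = D ∷ U ∷ []

isPrefix-++-D : ∀ {p} xs ys → All (_≢ D) p → isPrefix p (xs ++ D ∷ ys) ≡ isPrefix p xs
isPrefix-++-D          xs       ys All.[]            = refl
isPrefix-++-D {U ∷ p}  []       ys (_ All.∷ _)       = refl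
isPrefix-++-D {F ∷ p}  []       ys (_ All.∷ _)       = refl
isPrefix-++-D {D ∷ p}  []       ys (D≢D All.∷ _)     = ⊥-elim (D≢D refl)
isPrefix-++-D {s ∷ p}  (x ∷ xs) ys (_ All.∷ p≢D)     =
  cong (stepEq s x ∧_) (isPrefix-++-D xs ys p≢D)

occ-++-D : ∀ {s p} xs ys → All (_≢ D) p →
  occ (s ∷ p) (xs ++ D ∷ ys) ≡ occ (s ∷ p) xs + occ (s ∷ p) (D ∷ ys)
occ-++-D          []       ys p≢D = refl
occ-++-D {s} {p}  (x ∷ xs) ys p≢D =
  trans (cong₂ (λ b n → (if b then 1 else 0) + n)
               (cong (stepEq s x ∧_) (isPrefix-++-D xs ys p≢D)) (occ-++-D xs ys p≢D))
        (sym (+-assoc (if isPrefix (s ∷ p) (x ∷ xs) then 1 else 0) _ _))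

occ-UD-++-D : ∀ {j} xs ys → Walk j xs → occ UD (xs ++ D ∷ ys) ≡ occ UD xs + occ UD ys
occ-UD-++-D []           ys _        = refl
occ-UD-++-D (U ∷ [])     ys (U∷ ())
occ-UD-++-D (F ∷ [])     ys _        = refl
occ-UD-++-D (D ∷ [])     ys _        = refl
occ-UD-++-D (x ∷ y ∷ xs) ys p =
  trans (cong ((if isPrefix UD (x ∷ y ∷ xs) then 1 else 0) +_)
              (occ-UD-++-D (y ∷ xs) ys (proj₂ (Walk-tail p))))
        (sym (+-assoc (if isPrefix UD (x ∷ y ∷ xs) then 1 else 0) _ _))
  where
  Walk-tail : ∀ {j x w} → Walk j (x ∷ w) → ∃ λ i → Walk i w
  Walk-tail (U∷ p) = _ , p
  Walk-tail (F∷ p) = _ , p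
  Walk-tail (D∷ p) = _ , p

data Tree : Set where
  leaf : Tree
  flat : Tree → Tree
  peak : Tree → Tree
  node : Tree → Tree → Tree

startsUp : Tree → ℕ
startsUp (peak _)   = 1
startsUp (node _ _) = 1
startsUp _          = 0

weight : Tree → ℕ
weight leaf       = 0
weight (flat t)   = weight t
weight (peak t)   = weight t
weight (node a m) = startsUp a + weight a + weight m

uuPath : Tree → Word
uuPath leaf       = []
uuPath (flat t)   = F ∷ uuPath t
uuPath (peak t)   = U ∷ D ∷ uuPath t
uuPath (node a m) = U ∷ F ∷ uuPath a ++ D ∷ uuPath m

udPath : Tree → Word
udPath leaf       = F ∷ []
udPath (flat t)   = F ∷ udPath t
udPath (peak t)   = U ∷ udPath t ++ D ∷ []
udPath (node a m) = U ∷ udPath m ++ D ∷ udPath a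

uuPath-walk : ∀ t → Walk 0 (uuPath t)
uuPath-walk leaf       = []
uuPath-walk (flat t)   = F∷ uuPath-walk t
uuPath-walk (peak t)   = U∷ D∷ uuPath-walk t
uuPath-walk (node a m) = U∷ F∷ Walk-++ (uuPath-walk a) (D∷ uuPath-walk m)

udPath-walk : ∀ t → Walk 0 (udPath t)
udPath-walk leaf       = F∷ []
udPath-walk (flat t)   = F∷ udPath-walk t
udPath-walk (peak t)   = U∷ Walk-++ (udPath-walk t) (D∷ [])
udPath-walk (node a m) = U∷ Walk-++ (udPath-walk m) (D∷ udPath-walk a)

occ-UU-uuPath : ∀ t → occ UU (uuPath t) ≡ 0
occ-UU-uuPath leaf       = refl
occ-UU-uuPath (flat t)   = occ-UU-uuPath t
occ-UU-uuPath (peak t)   = occ-UU-uuPath t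
occ-UU-uuPath (node a m) =
  trans (occ-++-D (uuPath a) (uuPath m) ((λ ()) All.∷ All.[]))
        (cong₂ _+_ (occ-UU-uuPath a) (occ-UU-uuPath m))

occ-UFU-uuPath : ∀ t → occ UFU (uuPath t) ≡ weight t
occ-UFU-uuPath leaf       = refl
occ-UFU-uuPath (flat t)   = occ-UFU-uuPath t
occ-UFU-uuPath (peak t)   = occ-UFU-uuPath t
occ-UFU-uuPath (node a m) = begin
  occ UFU (uuPath (node a m))
    ≡⟨ cong₂ _+_ (UFU-at-root a)
                 (occ-++-D (uuPath a) (uuPath m) ((λ ()) All.∷ (λ ()) All.∷ All.[])) ⟩
  startsUp a + (occ UFU (uuPath a) + occ UFU (uuPath m))
    ≡⟨ cong (startsUp a +_) (cong₂ _+_ (occ-UFU-uuPath a) (occ-UFU-uuPath m)) ⟩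
  startsUp a + (weight a + weight m)
    ≡⟨ sym (+-assoc (startsUp a) _ _) ⟩
  weight (node a m) ∎
  where
  UFU-at-root : ∀ a →
    (if isPrefix (U ∷ []) (uuPath a ++ D ∷ uuPath m) then 1 else 0) ≡ startsUp a
  UFU-at-root leaf       = refl
  UFU-at-root (flat _)   = refl
  UFU-at-root (peak _)   = refl
  UFU-at-root (node _ _) = refl

occ-UD-U∷udPath-D∷ : ∀ t s → occ UD (U ∷ udPath t ++ D ∷ s) ≡ occ UD (udPath t) + occ UD s
occ-UD-U∷udPath-D∷ t s = trans (no-UD-at-U t) (occ-UD-++-D (udPath t) s (udPath-walk t))
  where
  no-UD-at-U : ∀ t → occ UD (U ∷ udPath t ++ D ∷ s) ≡ occ UD (udPath t ++ D ∷ s)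
  no-UD-at-U leaf       = refl
  no-UD-at-U (flat _)   = refl
  no-UD-at-U (peak _)   = refl
  no-UD-at-U (node _ _) = refl

occ-UD-udPath : ∀ t → occ UD (udPath t) ≡ 0
occ-UD-udPath leaf       = refl
occ-UD-udPath (flat t)   = occ-UD-udPath t
occ-UD-udPath (peak t)   = trans (occ-UD-U∷udPath-D∷ t []) (cong (_+ 0) (occ-UD-udPath t))
occ-UD-udPath (node a m) =
  trans (occ-UD-U∷udPath-D∷ m (udPath a)) (cong₂ _+_ (occ-UD-udPath m) (occ-UD-udPath a))

occ-DU-udPath : ∀ t → occ DU (udPath t) ≡ weight t
occ-DU-udPath leaf       = refl
occ-DU-udPath (flat t)   = occ-DU-udPath t
occ-DU-udPath (peak t)   = begin
  occ DU (udPath t ++ D ∷ [])     ≡⟨ occ-++-D (udPath t) [] ((λ ()) All.∷ All.[]) ⟩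
  occ DU (udPath t) + 0           ≡⟨ +-identityʳ _ ⟩
  occ DU (udPath t)               ≡⟨ occ-DU-udPath t ⟩
  weight t                        ∎
occ-DU-udPath (node a m) = begin
  occ DU (udPath m ++ D ∷ udPath a)
    ≡⟨ occ-++-D (udPath m) (udPath a) ((λ ()) All.∷ All.[]) ⟩
  occ DU (udPath m) + occ DU (D ∷ udPath a)
    ≡⟨ cong₂ _+_ (occ-DU-udPath m) (DU-at-root a) ⟩
  weight m + (startsUp a + occ DU (udPath a))
    ≡⟨ cong (λ i → weight m + (startsUp a + i)) (occ-DU-udPath a) ⟩
  weight m + (startsUp a + weight a)
    ≡⟨ +-comm (weight m) _ ⟩
  weight (node a m) ∎
  where
  DU-at-root : ∀ a → occ DU (D ∷ udPath a) ≡ startsUp a + occ DU (udPath a)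
  DU-at-root leaf       = refl
  DU-at-root (flat _)   = refl
  DU-at-root (peak _)   = refl
  DU-at-root (node _ _) = refl

length-udPath : ∀ t → length (udPath t) ≡ suc (length (uuPath t))
length-udPath leaf       = refl
length-udPath (flat t)   = cong suc (length-udPath t)
length-udPath (peak t)   = cong suc (begin
  length (udPath t ++ D ∷ [])          ≡⟨ length-++-∷ (udPath t) D [] ⟩
  suc (length (udPath t) + 0)          ≡⟨ cong suc (+-identityʳ _) ⟩
  suc (length (udPath t))              ≡⟨ cong suc (length-udPath t) ⟩
  suc (suc (length (uuPath t)))        ∎)
length-udPath (node a m) = cong suc (begin
  length (udPath m ++ D ∷ udPath a)
    ≡⟨ length-++-∷ (udPath m) D (udPath a) ⟩
  suc (length (udPath m) + length (udPath a))
    ≡⟨ cong suc (+-comm (length (udPath m)) _) ⟩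
  suc (length (udPath a) + length (udPath m))
    ≡⟨ cong suc (cong₂ _+_ (length-udPath a) (length-udPath m)) ⟩
  suc (suc (length (uuPath a)) + suc (length (uuPath m)))
    ≡⟨ cong (suc ∘ suc) (sym (length-++ (uuPath a))) ⟩
  suc (suc (length (uuPath a ++ D ∷ uuPath m))) ∎)

-- The pieces of a first-return decomposition are not subterms of the word, so the parsers
-- recurse on fuel; any fuel ≥ length w suffices. Words outside the classes parse to junk.
parseUU : ℕ → Word → Tree
parseUU zero    _           = leaf
parseUU (suc n) (F ∷ w)     = flat (parseUU n w)
parseUU (suc n) (U ∷ D ∷ w) = peak (parseUU n w)
parseUU (suc n) (U ∷ F ∷ w) = let (a , m) = splitAtReturn 0 w in node (parseUU n a) (parseUU n m)
parseUU (suc n) _           = leaf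

parseUD : ℕ → Word → Tree
parseLift : ℕ → Word → Word → Tree

parseUD zero    _       = leaf
parseUD (suc n) (F ∷ v) = if null v then leaf else flat (parseUD n v)
parseUD (suc n) (U ∷ v) = let (b , r) = splitAtReturn 0 v in parseLift n b r
parseUD (suc n) _       = leaf

parseLift n b r = if null r then peak (parseUD n b) else node (parseUD n r) (parseUD n b)

null-udPath : ∀ t → null (udPath t) ≡ false
null-udPath leaf       = refl
null-udPath (flat _)   = refl
null-udPath (peak _)   = refl
null-udPath (node _ _) = refl

parseUU-uuPath : ∀ t n → length (uuPath t) ≤ n → parseUU n (uuPath t) ≡ t
parseUU-uuPath leaf       zero    _         = refl
parseUU-uuPath leaf       (suc n) _         = refl
parseUU-uuPath (flat t)   (suc n) (s≤s le) = cong flat (parseUU-uuPath t n le)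
parseUU-uuPath (peak t)   (suc n) (s≤s le) = cong peak (parseUU-uuPath t n (<⇒≤ le))
parseUU-uuPath (node a m) (suc n) (s≤s le)
  rewrite splitAtReturn-++ (uuPath m) (uuPath-walk a)
  with la , lm ← length-pieces (uuPath a) D (uuPath m) (<⇒≤ le)
  = cong₂ node (parseUU-uuPath a n la) (parseUU-uuPath m n lm)

parseUD-udPath : ∀ t n → length (udPath t) ≤ n → parseUD n (udPath t) ≡ t
parseUD-udPath leaf       (suc n) _ = refl
parseUD-udPath (flat t)   (suc n) (s≤s le) rewrite null-udPath t = cong flat (parseUD-udPath t n le)
parseUD-udPath (peak t)   (suc n) (s≤s le)
  rewrite splitAtReturn-++ [] (udPath-walk t)
  = cong peak (parseUD-udPath t n (proj₁ (length-pieces (udPath t) D [] le)))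
parseUD-udPath (node a m) (suc n) (s≤s le)
  rewrite splitAtReturn-++ (udPath a) (udPath-walk m) | null-udPath a
  with lm , la ← length-pieces (udPath m) D (udPath a) le
  = cong₂ node (parseUD-udPath a n la) (parseUD-udPath m n lm)

uuPath-parseUU : ∀ n w → length w ≤ n → Walk 0 w → occ UU w ≡ 0 → uuPath (parseUU n w) ≡ w
uuPath-parseUU zero    []          _        _           _  = refl
uuPath-parseUU (suc n) []          _        _           _  = refl
uuPath-parseUU (suc n) (F ∷ w)     (s≤s le) (F∷ p)      av =
  cong (F ∷_) (uuPath-parseUU n w le p av)
uuPath-parseUU (suc n) (U ∷ D ∷ w) (s≤s le) (U∷ D∷ p)   av =
  cong (λ v → U ∷ D ∷ v) (uuPath-parseUU n w (<⇒≤ le) p av)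
uuPath-parseUU (suc n) (U ∷ F ∷ w) (s≤s le) (U∷ F∷ p)   av with firstReturn p
... | _·D·_ {a} {m} pa pm
  rewrite splitAtReturn-++ m pa
  with la , lm ← length-pieces a D m (<⇒≤ le)
  = cong (λ v → U ∷ F ∷ v) (cong₂ (λ a′ m′ → a′ ++ D ∷ m′)
      (uuPath-parseUU n a la pa (m+n≡0⇒m≡0 _ av′))
      (uuPath-parseUU n m lm pm (m+n≡0⇒n≡0 _ av′)))
  where
  av′ : occ UU a + occ UU m ≡ 0
  av′ = trans (sym (occ-++-D a m ((λ ()) All.∷ All.[]))) av

udPath-parseUD : ∀ n x v → length (x ∷ v) ≤ n → Walk 0 (x ∷ v) → occ UD (x ∷ v) ≡ 0 →
  udPath (parseUD n (x ∷ v)) ≡ x ∷ v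
udPath-parseLift : ∀ n {b r} → length (b ++ D ∷ r) ≤ n → Walk 0 b → Walk 0 r →
  occ UD (U ∷ b ++ D ∷ r) ≡ 0 → udPath (parseLift n b r) ≡ U ∷ b ++ D ∷ r

udPath-parseUD (suc n) F []      _        _      _  = refl
udPath-parseUD (suc n) F (y ∷ v) (s≤s le) (F∷ p) av = cong (F ∷_) (udPath-parseUD n y v le p av)
udPath-parseUD (suc n) U v       (s≤s le) (U∷ p) av with firstReturn p
... | _·D·_ {b} {r} pb pr rewrite splitAtReturn-++ r pb = udPath-parseLift n le pb pr av

udPath-parseLift n {[]} _ _ _ ()
udPath-parseLift n {y ∷ b} {r} le pb pr av
  with lb , lr ← length-pieces (y ∷ b) D r le
  with avb+avr ← trans (sym (occ-UD-++-D (y ∷ b) r pb))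
                       (m+n≡0⇒n≡0 (if isPrefix UD (U ∷ y ∷ b ++ D ∷ r) then 1 else 0) av)
  with IHb ← udPath-parseUD n y b lb pb (m+n≡0⇒m≡0 (occ UD (y ∷ b)) avb+avr)
  with r | pr
... | []    | _  = cong (λ s → U ∷ s ++ D ∷ []) IHb
... | z ∷ r | pr = cong₂ (λ s s′ → U ∷ s ++ D ∷ s′) IHb
                     (udPath-parseUD n z r lr pr (m+n≡0⇒n≡0 (occ UD (y ∷ b)) avb+avr))

uuPath-restricted : ∀ t → Restricted UU UFU (weight t) (uuPath t)
uuPath-restricted t = restricted (uuPath-walk t) (occ-UU-uuPath t) (occ-UFU-uuPath t)

udPath-restricted : ∀ t → Restricted UD DU (weight t) (udPath t)
udPath-restricted t = restricted (udPath-walk t) (occ-UD-udPath t) (occ-DU-udPath t)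

uuPath-surjective : ∀ {k w} → Restricted UU UFU k w → ∃ λ t → uuPath t ≡ w
uuPath-surjective {w = w} (restricted pw av _) = _ , uuPath-parseUU (length w) w ≤-refl pw av

udPath-surjective : ∀ {k v} → Restricted UD DU k v → v ≢ [] → ∃ λ t → udPath t ≡ v
udPath-surjective {v = []}    _                    v≢[] = ⊥-elim (v≢[] refl)
udPath-surjective {v = x ∷ v} (restricted pv av _) _    =
  _ , udPath-parseUD (length (x ∷ v)) x v ≤-refl pv av

uu→ud : Word → Word
uu→ud w = udPath (parseUU (length w) w)

ud→uu : Word → Word
ud→uu v = uuPath (parseUD (length v) v)

uu→ud-maps : ∀ {n k w} → length w ≡ n → Restricted UU UFU k w →
  length (uu→ud w) ≡ suc n × Restricted UD DU k (uu→ud w) × ud→uu (uu→ud w) ≡ w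
uu→ud-maps refl r with t , refl ← uuPath-surjective r
  with refl ← trans (sym (occ-UFU-uuPath t)) (Restricted.occurrences r)
  rewrite parseUU-uuPath t (length (uuPath t)) ≤-refl
        | parseUD-udPath t (length (udPath t)) ≤-refl
  = length-udPath t , udPath-restricted t , refl

ud→uu-maps : ∀ {n k v} → length v ≡ suc n → Restricted UD DU k v →
  length (ud→uu v) ≡ n × Restricted UU UFU k (ud→uu v) × uu→ud (ud→uu v) ≡ v
ud→uu-maps lv r with t , refl ← udPath-surjective r (λ { refl → 0≢1+n lv })
  with refl ← trans (sym (occ-DU-udPath t)) (Restricted.occurrences r)
  rewrite parseUD-udPath t (length (udPath t)) ≤-refl
        | parseUU-uuPath t (length (uuPath t)) ≤-refl
  = suc-injective (trans (sym (length-udPath t)) lv) , uuPath-restricted t , refl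

mainTheorem4 : (n k : ℕ) →
    countMotzkin n (U ∷ U ∷ []) (U ∷ F ∷ U ∷ []) k
      ≡ countMotzkin (suc n) (U ∷ D ∷ []) (D ∷ U ∷ []) k
mainTheorem4 n k = countMotzkin-≡ uu→ud ud→uu (uu→ud-maps {n} {k}) (ud→uu-maps {n} {k})
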